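{- In the setting below, for every rotor configuration $\rho$ there is no infinite sequence $\rho=\rho_0,\rho_1,\rho_2,\dots$ in which each $\rho_{i+1}$ is obtained from $\rho_i$ by pushing a cycle of $\rho_i$. Hence any sequence of cycle pushing moves starting from $\rho$, continued as long as a cycle exists, reaches an acyclic rotor configuration in finitely many steps.
   Context: $G=(V,E)$ is a finite strongly connected directed graph, $T\subseteq V$ a nonempty set of targets, $V_0=V\setminus T$, $d(v)$ the out-degree. At each $v\in V_0$ a rotor mechanism is fixed: an ordering $e_v^1,\dots,e_v^{d(v)}$ of the arcs leaving $v$, extended periodically; for $e=e_v^i$ put $e^-=e_v^{i-1}$. A rotor configuration is a map $\rho:V_0\to E$ with $\rho(v)$ an arc leaving $v$; $\rho$ is acyclic if the graph on $V$ with arc set $\{\rho(v):v\in V_0\}$ has no directed cycle. A cycle of $\rho$ is a sequence of distinct vertices $v_0,\dots,v_{r-1}\in V_0$ ($r\ge1$) with $\rho(v_j)$ an arc from $v_j$ to $v_{j+1}$ (indices mod $r$); pushing it gives $\mathcal{C}\rho$ with $\mathcal{C}\rho(v)=\rho(v)^-$ for $v$ on the cycle and $\mathcal{C}\rho(v)=\rho(v)$ otherwise. -}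

module Defs where

open import Data.Nat using (ℕ; zero; suc)
open import Data.Nat.Properties using (suc-injective)
open import Data.Fin using (Fin; zero; suc; toℕ; fromℕ; inject₁; lower₁)
open import Data.Bool using (Bool; true; false)
open import Data.Product using (Σ; ∃; ∃-syntax; _×_; _,_)
open import Relation.Nullary using (¬_; yes; no)
open import Relation.Binary.PropositionalEquality using (_≡_; _≢_; sym)
open import Relation.Binary.Construct.Closure.ReflexiveTransitive using (Star)
open import Function.Definitions using (Injective)

-- The arcs leaving v are indexed by Fin (d v) (so d v is
-- the out-degree); the i-th arc leaving v (0-based) goes to  head v i.
-- The rotor order at v is the index order  e_v^0, e_v^1, …, e_v^(d v - 1),
-- extended periodically.  T v ≡ true  means v is a target.
record RotorGraph : Set where
  field
    n    : ℕ
    d    : Fin n → ℕ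
    head : (v : Fin n) → Fin (d v) → Fin n
    T    : Fin n → Bool

module _ (G : RotorGraph) where
  open RotorGraph G

  Arc : Fin n → Fin n → Set
  Arc u w = ∃[ i ] head u i ≡ w

  StronglyConnected : Set
  StronglyConnected = ∀ u w → Star Arc u w

  TargetsNonempty : Set
  TargetsNonempty = ∃[ v ] T v ≡ true

  InV₀ : Fin n → Set
  InV₀ v = T v ≡ false

  Config : Set
  Config = (v : Fin n) → InV₀ v → Fin (d v)

nextMod : ∀ {k} → Fin (suc k) → Fin (suc k)
nextMod {k} j with toℕ j Data.Nat.≟ k
... | yes _ = zero
... | no ne = lower₁ (suc j) (λ eq → ne (sym (suc-injective eq)))

predMod : ∀ {d} → Fin d → Fin d
predMod {suc k} zero    = fromℕ k
predMod {suc k} (suc i) = inject₁ i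

module _ (G : RotorGraph) where
  open RotorGraph G

  record Cycle (ρ : Config G) : Set where
    field
      k     : ℕ
      vtx   : Fin (suc k) → Fin n
      inV₀  : (j : Fin (suc k)) → InV₀ G (vtx j)
      dist  : Injective _≡_ _≡_ vtx
      step  : (j : Fin (suc k)) → head (vtx j) (ρ (vtx j) (inV₀ j)) ≡ vtx (nextMod j)

  OnCycle : {ρ : Config G} → Cycle ρ → Fin n → Set
  OnCycle C v = ∃[ j ] Cycle.vtx C j ≡ v

  PushedBy : (ρ : Config G) → Cycle ρ → Config G → Set
  PushedBy ρ C ρ' =
    (∀ v (p : InV₀ G v) → OnCycle C v → ρ' v p ≡ predMod (ρ v p)) ×
    (∀ v (p : InV₀ G v) → ¬ OnCycle C v → ρ' v p ≡ ρ v p)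

  Push : Config G → Config G → Set
  Push ρ ρ' = Σ (Cycle ρ) λ C → PushedBy ρ C ρ'

  -- acyclic: the graph with arc set {ρ(v) : v ∈ V₀} has no directed cycle.
  -- Since in that graph every vertex has out-degree ≤ 1 and targets have
  -- out-degree 0, its directed cycles are exactly the cycles of ρ.
  Acyclic : Config G → Set
  Acyclic ρ = ¬ Cycle ρ

  InfinitePushSeq : Config G → Set
  InfinitePushSeq ρ = Σ (ℕ → Config G) λ s → (s 0 ≡ ρ) × (∀ i → Push (s i) (s (suc i)))

-- Fix v ∈ V₀ and the first arc a of a path from v to a target. Every push of
-- v turns its rotor one step back, so after fewer than d(v) pushes of v the
-- rotor is at a, and a push of v with rotor a pushes head(a) as well. Hence
-- #pushes(v) ≤ d(v)·(1 + #pushes(head a)); targets are never pushed, so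
-- induction along the path bounds #pushes(v) independently of the sequence.
-- Every push pushes some vertex, so the total number of pushes is bounded.
module Submission where

open import Defs
open import Data.Nat using (ℕ; zero; suc; _+_; _*_; _∸_; _≤_; _<_; z≤n; s≤s; _≤?_)
open import Data.Nat.Properties
open import Algebra.Properties.CommutativeMonoid.Sum +-0-commutativeMonoid
  using (sum; sum-syntax; ∑-distrib-+)
open import Data.Fin using (Fin; zero; suc; toℕ) renaming (_≟_ to _≟ᶠ_)
open import Data.Fin.Properties using (toℕ-fromℕ; toℕ-inject₁; toℕ-injective; toℕ<n; any?)
open import Data.Bool using (Bool; true; false)
import Data.Bool.Properties as Bool
open import Axiom.UniquenessOfIdentityProofs using (module Decidable⇒UIP)
open import Data.Product using (_×_; ∃-syntax; _,_; proj₁; proj₂)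
open import Data.Sum using (_⊎_; inj₁; inj₂)
open import Data.Empty using (⊥-elim)
open import Function using (_∘_)
open import Relation.Nullary using (¬_; yes; no; Dec)
open import Relation.Binary.PropositionalEquality
open import Relation.Binary.Construct.Closure.ReflexiveTransitive using (Star; ε; _◅_)

term≤∑ : ∀ {m} (f : Fin m → ℕ) i → f i ≤ ∑[ j < m ] f j
term≤∑ f zero    = m≤m+n _ _
term≤∑ f (suc i) = ≤-trans (term≤∑ (f ∘ suc) i) (m≤n+m _ _)

∑-mono-≤ : ∀ {m} {f g : Fin m → ℕ} → (∀ i → f i ≤ g i) → ∑[ i < m ] f i ≤ ∑[ i < m ] g i
∑-mono-≤ {zero}  f≤g = z≤n
∑-mono-≤ {suc m} f≤g = +-mono-≤ (f≤g zero) (∑-mono-≤ (f≤g ∘ suc))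

-- stepsBack d y x is the number of steps x ↦ x - 1 (mod d) leading from x to y.
stepsBack : ℕ → ℕ → ℕ → ℕ
stepsBack d y x with y ≤? x
... | yes _ = x ∸ y
... | no  _ = (d + x) ∸ y

stepsBack-< : ∀ d y x → x < suc d → stepsBack (suc d) y x < suc d
stepsBack-< d y x x<1+d with y ≤? x
... | yes _   = ≤-<-trans (m∸n≤m x y) x<1+d
... | no  y≰x = s≤s (begin
  suc (d + x) ∸ y     ≤⟨ ∸-monoʳ-≤ (suc (d + x)) (≰⇒> y≰x) ⟩
  suc (d + x) ∸ suc x ≡⟨ m+n∸n≡m d x ⟩
  d ∎)
  where open ≤-Reasoning

stepsBack-wrap : ∀ k y → 0 < y → y ≤ k → suc (stepsBack (suc k) y k) ≡ stepsBack (suc k) y 0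
stepsBack-wrap k y 0<y y≤k with y ≤? k | y ≤? 0
... | no y≰k | _     = ⊥-elim (y≰k y≤k)
... | yes _  | yes q = ⊥-elim (<-irrefl refl (≤-trans 0<y q))
... | yes _  | no _  = begin
  suc (k ∸ y)       ≡⟨ +-∸-assoc 1 y≤k ⟨
  suc k ∸ y         ≡⟨ cong (λ z → suc z ∸ y) (+-identityʳ k) ⟨
  (suc k + 0) ∸ y   ∎
  where open ≡-Reasoning

stepsBack-suc : ∀ d y x → y < d → y ≢ suc x → suc (stepsBack d y x) ≡ stepsBack d y (suc x)
stepsBack-suc d y x y<d y≢1+x with y ≤? x | y ≤? suc x
... | yes y≤x | yes _     = sym (+-∸-assoc 1 y≤x)
... | yes y≤x | no y≰1+x  = ⊥-elim (y≰1+x (m≤n⇒m≤1+n y≤x))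
... | no y≰x  | yes y≤1+x = ⊥-elim (y≢1+x (≤-antisym y≤1+x (≰⇒> y≰x)))
... | no _    | no _      = begin
  suc ((d + x) ∸ y)  ≡⟨ +-∸-assoc 1 (≤-trans (<⇒≤ y<d) (m≤m+n d x)) ⟨
  suc (d + x) ∸ y    ≡⟨ cong (_∸ y) (+-suc d x) ⟨
  (d + suc x) ∸ y    ∎
  where open ≡-Reasoning

rotorDistance : ∀ {d} → Fin d → Fin d → ℕ
rotorDistance {d} a r = stepsBack d (toℕ a) (toℕ r)

rotorDistance-< : ∀ {d} (a r : Fin d) → rotorDistance a r < d
rotorDistance-< {suc d} a r = stepsBack-< d (toℕ a) (toℕ r) (toℕ<n r)

rotorDistance-predMod : ∀ {d} (a r : Fin d) → r ≢ a →
                        suc (rotorDistance a (predMod r)) ≡ rotorDistance a r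
rotorDistance-predMod {suc k} zero    zero    r≢a = ⊥-elim (r≢a refl)
rotorDistance-predMod {suc k} (suc a) zero    _   rewrite toℕ-fromℕ k =
  stepsBack-wrap k (suc (toℕ a)) (s≤s z≤n) (≤-pred (toℕ<n (suc a)))
rotorDistance-predMod {suc k} a       (suc i) r≢a rewrite toℕ-inject₁ i =
  stepsBack-suc (suc k) (toℕ a) (toℕ i) (toℕ<n a) (r≢a ∘ toℕ-injective ∘ sym)

≡false-irrelevant : ∀ {b : Bool} (p q : b ≡ false) → p ≡ q
≡false-irrelevant = Decidable⇒UIP.≡-irrelevant Bool._≟_

module _ (G : RotorGraph) where
  open RotorGraph G

  data Run : ℕ → Config G → Set where
    []  : ∀ {ρ} → Run 0 ρ
    _∷_ : ∀ {m ρ ρ'} → Push G ρ ρ' → Run m ρ' → Run (suc m) ρ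

  onCycle? : ∀ {ρ} (C : Cycle G ρ) v → Dec (OnCycle G C v)
  onCycle? C v = any? (λ j → Cycle.vtx C j ≟ᶠ v)

  onCycle-inV₀ : ∀ {ρ} (C : Cycle G ρ) {v} → OnCycle G C v → InV₀ G v
  onCycle-inV₀ C (j , refl) = Cycle.inV₀ C j

  onCycle-head : ∀ {ρ} (C : Cycle G ρ) {v} (p : InV₀ G v) →
                 OnCycle G C v → OnCycle G C (head v (ρ v p))
  onCycle-head {ρ} C p (j , refl) =
    nextMod j , sym (trans (cong (λ q → head (vtx j) (ρ (vtx j) q)) (≡false-irrelevant p (inV₀ j))) (step j))
    where open Cycle C

  visits : ∀ {ρ} → Cycle G ρ → Fin n → ℕ
  visits C v with onCycle? C v
  ... | yes _ = 1
  ... | no  _ = 0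

  visits-onCycle : ∀ {ρ} (C : Cycle G ρ) {v} → OnCycle G C v → visits C v ≡ 1
  visits-onCycle C {v} on with onCycle? C v
  ... | yes _ = refl
  ... | no off = ⊥-elim (off on)

  pushes : ∀ {m ρ} → Fin n → Run m ρ → ℕ
  pushes v []            = 0
  pushes v ((C , _) ∷ r) = visits C v + pushes v r

  pushesWithRotor : ∀ {m ρ} v (p : InV₀ G v) (a : Fin (d v)) → Run m ρ → ℕ
  pushesWithRotor v p a [] = 0
  pushesWithRotor {ρ = ρ} v p a ((C , _) ∷ r) with onCycle? C v | ρ v p ≟ᶠ a
  ... | yes _ | yes _ = suc (pushesWithRotor v p a r)
  ... | yes _ | no  _ = pushesWithRotor v p a r
  ... | no  _ | _     = pushesWithRotor v p a r

  length≤∑pushes : ∀ {m ρ} (r : Run m ρ) → m ≤ ∑[ v < n ] pushes v r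
  length≤∑pushes [] = z≤n
  length≤∑pushes ((C , _) ∷ r) = begin
    suc _                                         ≤⟨ +-mono-≤ first≤ (length≤∑pushes r) ⟩
    ∑[ v < n ] visits C v + ∑[ v < n ] pushes v r ≡⟨ ∑-distrib-+ (visits C) (λ v → pushes v r) ⟨
    ∑[ v < n ] (visits C v + pushes v r)          ∎
    where
    open ≤-Reasoning
    first≤ : 1 ≤ ∑[ v < n ] visits C v
    first≤ = subst (_≤ ∑[ v < n ] visits C v) (visits-onCycle C (zero , refl)) (term≤∑ (visits C) (Cycle.vtx C zero))

  pushes-target : ∀ {m ρ} t → T t ≡ true → (r : Run m ρ) → pushes t r ≡ 0
  pushes-target t _ [] = refl
  pushes-target t t∈T ((C , _) ∷ r) with onCycle? C t
  ... | yes on with trans (sym t∈T) (onCycle-inV₀ C on)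
  ...   | ()
  pushes-target t t∈T ((C , _) ∷ r) | no _ = pushes-target t t∈T r

  pushes≤rotorDistance+d*pushesWithRotor :
    ∀ {m ρ} v (p : InV₀ G v) (a : Fin (d v)) (r : Run m ρ) →
      pushes v r ≤ rotorDistance a (ρ v p) + d v * pushesWithRotor v p a r
  pushes≤rotorDistance+d*pushesWithRotor v p a [] = z≤n
  pushes≤rotorDistance+d*pushesWithRotor {ρ = ρ} v p a (_∷_ {ρ' = ρ'} (C , moved , fixed) r)
    with onCycle? C v | ρ v p ≟ᶠ a | pushes≤rotorDistance+d*pushesWithRotor v p a r
  ... | yes _ | yes _ | ih = begin
    suc (pushes v r)                                  ≤⟨ s≤s ih ⟩
    suc (rotorDistance a (ρ' v p) + d v * k)          ≤⟨ +-monoˡ-≤ _ (rotorDistance-< a (ρ' v p)) ⟩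
    d v + d v * k                                     ≡⟨ *-suc (d v) k ⟨
    d v * suc k                                       ≤⟨ m≤n+m _ _ ⟩
    rotorDistance a (ρ v p) + d v * suc k             ∎
    where open ≤-Reasoning; k = pushesWithRotor v p a r
  ... | yes on | no ρv≢a | ih = begin
    suc (pushes v r)                                  ≤⟨ s≤s ih ⟩
    suc (rotorDistance a (ρ' v p) + d v * k)          ≡⟨ cong (λ z → suc (rotorDistance a z + d v * k)) (moved v p on) ⟩
    suc (rotorDistance a (predMod (ρ v p))) + d v * k ≡⟨ cong (_+ d v * k) (rotorDistance-predMod a (ρ v p) ρv≢a) ⟩
    rotorDistance a (ρ v p) + d v * k                 ∎
    where open ≤-Reasoning; k = pushesWithRotor v p a r
  ... | no off | _ | ih =
    subst (λ z → pushes v r ≤ rotorDistance a z + d v * pushesWithRotor v p a r) (fixed v p off) ih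

  pushesWithRotor≤pushes-head : ∀ {m ρ} v (p : InV₀ G v) (a : Fin (d v)) (r : Run m ρ) →
                                pushesWithRotor v p a r ≤ pushes (head v a) r
  pushesWithRotor≤pushes-head v p a [] = z≤n
  pushesWithRotor≤pushes-head {ρ = ρ} v p a ((C , _) ∷ r) with onCycle? C v | ρ v p ≟ᶠ a
  ... | yes on | yes refl =
    subst (λ z → suc (pushesWithRotor v p a r) ≤ z + pushes (head v a) r)
          (sym (visits-onCycle C (onCycle-head C p on)))
          (s≤s (pushesWithRotor≤pushes-head v p a r))
  ... | yes _ | no _ = ≤-trans (pushesWithRotor≤pushes-head v p a r) (m≤n+m _ _)
  ... | no _  | _    = ≤-trans (pushesWithRotor≤pushes-head v p a r) (m≤n+m _ _)

  PushesBounded : Fin n → Set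
  PushesBounded v = ∃[ B ] (∀ {m ρ} (r : Run m ρ) → pushes v r ≤ B)

  pushesBounded-path : ∀ {v t} → Star (Arc G) v t → T t ≡ true → PushesBounded v
  pushesBounded-path {v} ε t∈T = 0 , λ r → ≤-reflexive (pushes-target v t∈T r)
  pushesBounded-path {v} ((a , refl) ◅ path) t∈T with pushesBounded-path path t∈T | T v in v∈?
  ... | _ | true = 0 , λ r → ≤-reflexive (pushes-target v v∈? r)
  ... | B , pushes≤B | false = d v + d v * B , λ r →
    ≤-trans (pushes≤rotorDistance+d*pushesWithRotor v v∈? a r)
            (+-mono-≤ (<⇒≤ (rotorDistance-< a _))
                      (*-monoʳ-≤ (d v) (≤-trans (pushesWithRotor≤pushes-head v v∈? a r) (pushes≤B r))))

  runs-bounded : StronglyConnected G → TargetsNonempty G →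
                 ∃[ N ] (∀ {m ρ} → Run m ρ → m ≤ N)
  runs-bounded sc (t , t∈T) = ∑[ v < n ] proj₁ (bound v) , λ r →
    ≤-trans (length≤∑pushes r) (∑-mono-≤ (λ v → proj₂ (bound v) r))
    where
    bound : ∀ v → PushesBounded v
    bound v = pushesBounded-path (sc v t) t∈T

  runOrAcyclic : (s : ℕ → Config G) → (∀ i → Acyclic G (s i) ⊎ Push G (s i) (s (suc i))) →
                 ∀ m i → (∃[ j ] Acyclic G (s j)) ⊎ Run m (s i)
  runOrAcyclic s step zero i = inj₂ []
  runOrAcyclic s step (suc m) i with step i
  ... | inj₁ acyclic = inj₁ (i , acyclic)
  ... | inj₂ push with runOrAcyclic s step m (suc i)
  ...   | inj₁ found = inj₁ found
  ...   | inj₂ run   = inj₂ (push ∷ run)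

lemma3p7 : (G : RotorGraph) → StronglyConnected G → TargetsNonempty G →
    (ρ : Config G) →
    ¬ InfinitePushSeq G ρ
    × ((s : ℕ → Config G) → s 0 ≡ ρ →
    (∀ i → Acyclic G (s i) ⊎ Push G (s i) (s (suc i))) →
    ∃[ i ] Acyclic G (s i))
lemma3p7 G sc targets ρ = noInfinite , reachesAcyclic
  where
  N : ℕ
  N = proj₁ (runs-bounded G sc targets)

  noLongRun : ∀ {ρ} → ¬ Run G (suc N) ρ
  noLongRun r = <-irrefl refl (proj₂ (runs-bounded G sc targets) r)

  reachesAcyclic : (s : ℕ → Config G) → s 0 ≡ ρ →
    (∀ i → Acyclic G (s i) ⊎ Push G (s i) (s (suc i))) → ∃[ i ] Acyclic G (s i)
  reachesAcyclic s _ step with runOrAcyclic G s step (suc N) 0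
  ... | inj₁ found = found
  ... | inj₂ run   = ⊥-elim (noLongRun run)

  noInfinite : ¬ InfinitePushSeq G ρ
  noInfinite (s , s0≡ρ , push) =
    let (j , acyclic) = reachesAcyclic s s0≡ρ (inj₂ ∘ push) in acyclic (proj₁ (push j))
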